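{- Let $M$ be a marking for a permutation $\pi\in S_n$. Then $M$ is balanced if and only if it is s-balanced.
   Context: $\pi=[\dots a\dots b\dots]$ means $a$ occurs at an earlier position than $b$ in $\pi$. An inversion of $\pi$ is a pair $(a,b)$ with $a>b$ and $\pi=[\dots a\dots b\dots]$. Element $i$ is right if in some inversion $(i,j)$, left if in some inversion $(j,i)$; left-straight if left but not right; right-straight if right but not left; straight if left-straight or right-straight; a switchback if both left and right. A marking for $\pi$ is a function $M$ from $\{1,\dots,n\}$ to strings in letters $L,R$ with $M(i)=L$ for left-straight $i$, $M(i)=R$ for right-straight $i$, $M(i)\in\{LR,RL\}$ for switchbacks, and $M(i)=\emptyset$ (empty string) otherwise. A quadruple $(a,b,c,d)$ is a rec in $\pi$ if $\pi=[\dots a\dots b\dots c\dots d\dots]$ and $\min\{a,b\}>\max\{c,d\}$. Under $M$, $e$ is a left switchback of the rec if $M(e)=RL$, $\pi=[\dots a\dots e\dots b\dots]$, and $e$ is strictly between $c$ and $d$ in value; a right switchback if $M(e)=LR$, $\pi=[\dots c\dots e\dots d\dots]$, and $e$ is strictly between $a$ and $b$ in value. The rec is regular if $a<b$ and $c<d$, irregular otherwise; balanced if it has equally many left and right switchbacks; empty if it has none; straight if $a,b,c,d$ are all straight elements. $M$ is balanced if every regular rec is balanced and every irregular rec is empty under $M$; $M$ is s-balanced if every straight rec is balanced and every irregular rec is empty under $M$. -}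

module Defs where

open import Data.Nat using (ℕ)
open import Data.Fin using (Fin; _<_; _<?_)
open import Data.Fin.Permutation using (Permutation′; _⟨$⟩ʳ_; _⟨$⟩ˡ_)
open import Data.List using (List; []; _∷_; length; filter)
open import Data.List.Properties using (≡-dec)
open import Data.List using (allFin)
open import Data.Product using (Σ; ∃; _×_; _,_)
open import Data.Sum using (_⊎_)
open import Relation.Nullary using (¬_; Dec; yes; no)
open import Relation.Nullary.Decidable using (_×-dec_; _⊎-dec_)
open import Relation.Binary.PropositionalEquality using (_≡_; refl)

data Letter : Set where
  L R : Letter

_≟L_ : (x y : Letter) → Dec (x ≡ y)
L ≟L L = yes refl
L ≟L R = no λ ()
R ≟L L = no λ ()
R ≟L R = yes refl

-- Convention: the permutation π ∈ S_n is a bijection Fin n → Fin n sending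
-- a position k to the entry π(k) at that position (values 0..n-1 stand for 1..n).
-- pos π a is the position of the element a in π.
pos : {n : ℕ} → Permutation′ n → Fin n → Fin n
pos π a = π ⟨$⟩ˡ a

Before : {n : ℕ} → Permutation′ n → Fin n → Fin n → Set
Before π a b = pos π a < pos π b

Inversion : {n : ℕ} → Permutation′ n → Fin n → Fin n → Set
Inversion π a b = (b < a) × Before π a b

IsRight : {n : ℕ} → Permutation′ n → Fin n → Set
IsRight π i = ∃ λ j → Inversion π i j

IsLeft : {n : ℕ} → Permutation′ n → Fin n → Set
IsLeft π i = ∃ λ j → Inversion π j i

LeftStraight : {n : ℕ} → Permutation′ n → Fin n → Set
LeftStraight π i = IsLeft π i × ¬ IsRight π i

RightStraight : {n : ℕ} → Permutation′ n → Fin n → Set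
RightStraight π i = IsRight π i × ¬ IsLeft π i

Straight : {n : ℕ} → Permutation′ n → Fin n → Set
Straight π i = LeftStraight π i ⊎ RightStraight π i

Switchback : {n : ℕ} → Permutation′ n → Fin n → Set
Switchback π i = IsLeft π i × IsRight π i

Lw Rw LRw RLw : List Letter
Lw = L ∷ []
Rw = R ∷ []
LRw = L ∷ R ∷ []
RLw = R ∷ L ∷ []

Marking-for : {n : ℕ} → Permutation′ n → Set
Marking-for {n} π = Fin n → List Letter

IsMarking : {n : ℕ} (π : Permutation′ n) → (Fin n → List Letter) → Set
IsMarking {n} π M = (i : Fin n) →
    (LeftStraight π i → M i ≡ Lw)
  × (RightStraight π i → M i ≡ Rw)
  × (Switchback π i → (M i ≡ LRw ⊎ M i ≡ RLw))
  × (¬ IsLeft π i → ¬ IsRight π i → M i ≡ [])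

Rec : {n : ℕ} → Permutation′ n → Fin n → Fin n → Fin n → Fin n → Set
Rec π a b c d =
  Before π a b × Before π b c × Before π c d ×
  (c < a) × (d < a) × (c < b) × (d < b)

StrictlyBetween : {n : ℕ} → Fin n → Fin n → Fin n → Set
StrictlyBetween e x y = ((x < e) × (e < y)) ⊎ ((y < e) × (e < x))

strictlyBetween? : {n : ℕ} (e x y : Fin n) → Dec (StrictlyBetween e x y)
strictlyBetween? e x y = ((x <? e) ×-dec (e <? y)) ⊎-dec ((y <? e) ×-dec (e <? x))

before? : {n : ℕ} (π : Permutation′ n) (a b : Fin n) → Dec (Before π a b)
before? π a b = pos π a <? pos π b

LeftSwitchbackOf : {n : ℕ} → Permutation′ n → (Fin n → List Letter) →
                   Fin n → Fin n → Fin n → Fin n → Fin n → Set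
LeftSwitchbackOf π M a b c d e =
  (M e ≡ RLw) × Before π a e × Before π e b × StrictlyBetween e c d

RightSwitchbackOf : {n : ℕ} → Permutation′ n → (Fin n → List Letter) →
                    Fin n → Fin n → Fin n → Fin n → Fin n → Set
RightSwitchbackOf π M a b c d e =
  (M e ≡ LRw) × Before π c e × Before π e d × StrictlyBetween e a b

leftSwitchbackOf? : {n : ℕ} (π : Permutation′ n) (M : Fin n → List Letter)
                    (a b c d e : Fin n) → Dec (LeftSwitchbackOf π M a b c d e)
leftSwitchbackOf? π M a b c d e =
  ≡-dec _≟L_ (M e) RLw ×-dec before? π a e ×-dec before? π e b ×-dec strictlyBetween? e c d

rightSwitchbackOf? : {n : ℕ} (π : Permutation′ n) (M : Fin n → List Letter)
                     (a b c d e : Fin n) → Dec (RightSwitchbackOf π M a b c d e)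
rightSwitchbackOf? π M a b c d e =
  ≡-dec _≟L_ (M e) LRw ×-dec before? π c e ×-dec before? π e d ×-dec strictlyBetween? e a b

#LeftSwitchbacks : {n : ℕ} → Permutation′ n → (Fin n → List Letter) →
                   Fin n → Fin n → Fin n → Fin n → ℕ
#LeftSwitchbacks {n} π M a b c d = length (filter (leftSwitchbackOf? π M a b c d) (allFin n))

#RightSwitchbacks : {n : ℕ} → Permutation′ n → (Fin n → List Letter) →
                    Fin n → Fin n → Fin n → Fin n → ℕ
#RightSwitchbacks {n} π M a b c d = length (filter (rightSwitchbackOf? π M a b c d) (allFin n))

Regular : {n : ℕ} → Fin n → Fin n → Fin n → Fin n → Set
Regular a b c d = (a < b) × (c < d)

Irregular : {n : ℕ} → Fin n → Fin n → Fin n → Fin n → Set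
Irregular a b c d = ¬ Regular a b c d

BalancedRec : {n : ℕ} → Permutation′ n → (Fin n → List Letter) →
              Fin n → Fin n → Fin n → Fin n → Set
BalancedRec π M a b c d = #LeftSwitchbacks π M a b c d ≡ #RightSwitchbacks π M a b c d

EmptyRec : {n : ℕ} → Permutation′ n → (Fin n → List Letter) →
           Fin n → Fin n → Fin n → Fin n → Set
EmptyRec {n} π M a b c d = (e : Fin n) →
  ¬ LeftSwitchbackOf π M a b c d e × ¬ RightSwitchbackOf π M a b c d e

StraightRec : {n : ℕ} → Permutation′ n → Fin n → Fin n → Fin n → Fin n → Set
StraightRec π a b c d = Straight π a × Straight π b × Straight π c × Straight π d

BalancedMarking : {n : ℕ} → Permutation′ n → (Fin n → List Letter) → Set
BalancedMarking {n} π M = (a b c d : Fin n) → Rec π a b c d →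
  (Regular a b c d → BalancedRec π M a b c d) ×
  (Irregular a b c d → EmptyRec π M a b c d)

SBalancedMarking : {n : ℕ} → Permutation′ n → (Fin n → List Letter) → Set
SBalancedMarking {n} π M = (a b c d : Fin n) → Rec π a b c d →
  (StraightRec π a b c d → BalancedRec π M a b c d) ×
  (Irregular a b c d → EmptyRec π M a b c d)

-- Both the left switchbacks of a rec (a,b,c,d) and its right switchbacks are the
-- elements of a fixed marking lying in a "window": a position interval times a
-- value interval.  Window counts are additive when an interval is split at an
-- element lying outside the other interval, and irregular recs, being empty,
-- have zero window counts.  If a regular rec is not straight, one of its corners
-- is a switchback, witnessed by an inversion with some j; replacing that corner
-- by j either gives a regular rec with the same counts, or shows (via two empty
-- irregular recs) that both counts vanish.  The replacement decreases
-- (n - a) + (n - b) + c + d, so induction reduces every regular rec to a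
-- straight one.
module Submission where

open import Defs
open import Data.Nat using (ℕ; suc; _+_; _∸_) renaming (_<_ to _<ℕ_)
open import Data.Nat.Properties
  using (+-suc; +-identityʳ; +-monoˡ-<; +-monoʳ-<; ∸-monoʳ-<; <⇒≤; m+n≡0⇒m≡0; m+n≡0⇒n≡0)
open import Data.Nat.Induction using (<-wellFounded)
open import Data.Fin using (Fin; toℕ; _<_; _<?_)
open import Data.Fin.Properties using (<-trans; <-asym; <-cmp; any?; toℕ<n)
open import Data.Fin.Permutation using (Permutation′; _⟨$⟩ʳ_; inverseʳ)
open import Data.List using (List; []; _∷_; length; filter; allFin)
open import Data.List.Properties using (≡-dec; filter-≐; filter-none)
open import Data.List.Relation.Unary.All using (universal)
open import Data.Product using (_×_; _,_; proj₁; proj₂)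
open import Data.Sum using (_⊎_; inj₁; inj₂; [_,_]) renaming (swap to ⊎-swap)
open import Data.Empty using (⊥-elim)
open import Induction.WellFounded using (Acc; acc)
open import Relation.Nullary using (¬_; Dec; yes; no)
open import Relation.Nullary.Decidable using (_×-dec_)
open import Level using (0ℓ)
open import Relation.Unary using (Pred; Decidable; _≐_; _∪_; _⊥_)
open import Relation.Binary using (Tri; tri<; tri≈; tri>)
open import Relation.Binary.PropositionalEquality
  using (_≡_; refl; sym; trans; cong; module ≡-Reasoning)
open import Function.Bundles using (_⇔_; mk⇔)

module _ {A : Set} {P Q R : Pred A 0ℓ}
         (P? : Decidable P) (Q? : Decidable Q) (R? : Decidable R) where

  length-filter-⊎ : P ≐ Q ∪ R → Q ⊥ R → ∀ xs →
    length (filter P? xs) ≡ length (filter Q? xs) + length (filter R? xs)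
  length-filter-⊎ _ _ [] = refl
  length-filter-⊎ (P⊆Q∪R , Q∪R⊆P) Q⊥R (x ∷ xs) with P? x | Q? x | R? x
  ... | yes _  | yes q  | yes r = ⊥-elim (Q⊥R (q , r))
  ... | yes _  | yes _  | no _  = cong suc (length-filter-⊎ (P⊆Q∪R , Q∪R⊆P) Q⊥R xs)
  ... | yes _  | no _   | yes _ =
    trans (cong suc (length-filter-⊎ (P⊆Q∪R , Q∪R⊆P) Q⊥R xs)) (sym (+-suc _ _))
  ... | yes p  | no ¬q  | no ¬r = ⊥-elim ([ ¬q , ¬r ] (P⊆Q∪R p))
  ... | no ¬p  | yes q  | _     = ⊥-elim (¬p (Q∪R⊆P (inj₁ q)))
  ... | no ¬p  | no _   | yes r = ⊥-elim (¬p (Q∪R⊆P (inj₂ r)))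
  ... | no _   | no _   | no _  = length-filter-⊎ (P⊆Q∪R , Q∪R⊆P) Q⊥R xs

above⇒¬strictlyBetween : ∀ {n} {q x y : Fin n} → x < q → y < q → ¬ StrictlyBetween q x y
above⇒¬strictlyBetween x<q y<q (inj₁ (_ , q<y)) = <-asym y<q q<y
above⇒¬strictlyBetween x<q y<q (inj₂ (_ , q<x)) = <-asym x<q q<x

below⇒¬strictlyBetween : ∀ {n} {q x y : Fin n} → q < x → q < y → ¬ StrictlyBetween q x y
below⇒¬strictlyBetween q<x q<y (inj₁ (x<q , _)) = <-asym q<x x<q
below⇒¬strictlyBetween q<x q<y (inj₂ (y<q , _)) = <-asym q<y y<q

rank : ∀ {n} → Fin n → Fin n → Fin n → Fin n → ℕ
rank {n} a b c d = (n ∸ toℕ a + (n ∸ toℕ b)) + (toℕ c + toℕ d)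

∸-toℕ-< : ∀ {n} {i j : Fin n} → i < j → n ∸ toℕ j <ℕ n ∸ toℕ i
∸-toℕ-< {j = j} i<j = ∸-monoʳ-< i<j (<⇒≤ (toℕ<n j))

module _ {n : ℕ} (a b c d : Fin n) {j : Fin n} where

  rank-raise-a : a < j → rank j b c d <ℕ rank a b c d
  rank-raise-a a<j = +-monoˡ-< _ (+-monoˡ-< _ (∸-toℕ-< a<j))

  rank-raise-b : b < j → rank a j c d <ℕ rank a b c d
  rank-raise-b b<j = +-monoˡ-< _ (+-monoʳ-< (n ∸ toℕ a) (∸-toℕ-< b<j))

  rank-lower-c : j < c → rank a b j d <ℕ rank a b c d
  rank-lower-c j<c = +-monoʳ-< (n ∸ toℕ a + (n ∸ toℕ b)) (+-monoˡ-< (toℕ d) j<c)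

  rank-lower-d : j < d → rank a b c j <ℕ rank a b c d
  rank-lower-d j<d = +-monoʳ-< (n ∸ toℕ a + (n ∸ toℕ b)) (+-monoʳ-< (toℕ c) j<d)

module Windows {n : ℕ} (π : Permutation′ n) (M : Fin n → List Letter) where

  pos-injective : ∀ {x y} → pos π x ≡ pos π y → x ≡ y
  pos-injective {x} {y} eq = begin
    x                      ≡⟨ sym (inverseʳ π) ⟩
    π ⟨$⟩ʳ pos π x          ≡⟨ cong (π ⟨$⟩ʳ_) eq ⟩
    π ⟨$⟩ʳ pos π y          ≡⟨ inverseʳ π ⟩
    y                      ∎
    where open ≡-Reasoning

  before-cmp : ∀ x y → Tri (Before π x y) (x ≡ y) (Before π y x)
  before-cmp x y with <-cmp (pos π x) (pos π y)
  ... | tri< x<y x≢y x≯y = tri< x<y (λ { refl → x≢y refl }) x≯y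
  ... | tri≈ x≮y x≡y x≯y = tri≈ x≮y (pos-injective x≡y) x≯y
  ... | tri> x≮y x≢y x>y = tri> x≮y (λ { refl → x≢y refl }) x>y

  -- The left switchbacks of (a,b,c,d) are  Window RLw a b c d  and its right
  -- switchbacks are  Window LRw c d a b, definitionally.
  Window : List Letter → (p q x y : Fin n) → Pred (Fin n) 0ℓ
  Window w p q x y e = (M e ≡ w) × Before π p e × Before π e q × StrictlyBetween e x y

  window? : ∀ w p q x y → Decidable (Window w p q x y)
  window? w p q x y e =
    ≡-dec _≟L_ (M e) w ×-dec before? π p e ×-dec before? π e q ×-dec strictlyBetween? e x y

  #Window : List Letter → (p q x y : Fin n) → ℕ
  #Window w p q x y = length (filter (window? w p q x y) (allFin n))

  #Window-flip : ∀ {w p q} x y → #Window w p q x y ≡ #Window w p q y x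
  #Window-flip {w} {p} {q} x y =
    cong length (filter-≐ (window? w p q x y) (window? w p q y x) (flip , flip) (allFin n))
    where
      flip : ∀ {x y e} → Window w p q x y e → Window w p q y x e
      flip (m , pe , eq , between) = m , pe , eq , ⊎-swap between

  #Window-split-position : ∀ {w p q r x y} → Before π p q → Before π q r →
    ¬ StrictlyBetween q x y → #Window w p r x y ≡ #Window w p q x y + #Window w q r x y
  #Window-split-position {w} {p} {q} {r} {x} {y} pq qr q∉xy =
    length-filter-⊎ (window? w p r x y) (window? w p q x y) (window? w q r x y)
      (split , [ (λ (m , pe , eq , b) → m , pe , <-trans eq qr , b)
               , (λ (m , qe , er , b) → m , <-trans pq qe , er , b) ])
      (λ ((_ , _ , eq , _) , (_ , qe , _ , _)) → <-asym eq qe)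
      (allFin n)
    where
      split : ∀ {e} → Window w p r x y e → (Window w p q x y ∪ Window w q r x y) e
      split {e} (m , pe , er , b) with before-cmp e q
      ... | tri< eq _ _ = inj₁ (m , pe , eq , b)
      ... | tri≈ _ refl _ = ⊥-elim (q∉xy b)
      ... | tri> _ _ qe = inj₂ (m , qe , er , b)

  #Window-split-value : ∀ {w p q x y z} → x < y → y < z → Before π y p ⊎ Before π q y →
    #Window w p q x z ≡ #Window w p q x y + #Window w p q y z
  #Window-split-value {w} {p} {q} {x} {y} {z} x<y y<z y∉pq =
    length-filter-⊎ (window? w p q x z) (window? w p q x y) (window? w p q y z)
      (split , [ (λ (m , pe , eq , b) → m , pe , eq , inj₁ (widen-up (lower b)))
               , (λ (m , pe , eq , b) → m , pe , eq , inj₁ (widen-down (upper b))) ])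
      (λ ((_ , _ , _ , b) , (_ , _ , _ , b′)) → <-asym (proj₂ (lower b)) (proj₁ (upper b′)))
      (allFin n)
    where
      lower : ∀ {e} → StrictlyBetween e x y → x < e × e < y
      lower (inj₁ x<e<y) = x<e<y
      lower (inj₂ (y<e , e<x)) = ⊥-elim (<-asym x<y (<-trans y<e e<x))
      upper : ∀ {e} → StrictlyBetween e y z → y < e × e < z
      upper (inj₁ y<e<z) = y<e<z
      upper (inj₂ (z<e , e<y)) = ⊥-elim (<-asym y<z (<-trans z<e e<y))
      widen-up : ∀ {e} → x < e × e < y → x < e × e < z
      widen-up (x<e , e<y) = x<e , <-trans e<y y<z
      widen-down : ∀ {e} → y < e × e < z → x < e × e < z
      widen-down (y<e , e<z) = <-trans x<y y<e , e<z
      split : ∀ {e} → Window w p q x z e → (Window w p q x y ∪ Window w p q y z) e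
      split (m , pe , eq , inj₂ (z<e , e<x)) =
        ⊥-elim (<-asym (<-trans x<y y<z) (<-trans z<e e<x))
      split {e} (m , pe , eq , inj₁ (x<e , e<z)) with <-cmp e y
      ... | tri< e<y _ _ = inj₁ (m , pe , eq , inj₁ (x<e , e<y))
      ... | tri≈ _ refl _ = ⊥-elim ([ (λ yp → <-asym yp pe) , (λ qy → <-asym qy eq) ] y∉pq)
      ... | tri> _ _ y<e = inj₂ (m , pe , eq , inj₁ (y<e , e<z))

  NoSwitchbacks : (a b c d : Fin n) → Set
  NoSwitchbacks a b c d = #Window RLw a b c d ≡ 0 × #Window LRw c d a b ≡ 0

  emptyRec⇒noSwitchbacks : ∀ {a b c d} → EmptyRec π M a b c d → NoSwitchbacks a b c d
  emptyRec⇒noSwitchbacks {a} {b} {c} {d} empty =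
      cong length (filter-none (window? RLw a b c d) (universal (λ e → proj₁ (empty e)) (allFin n)))
    , cong length (filter-none (window? LRw c d a b) (universal (λ e → proj₂ (empty e)) (allFin n)))

  noSwitchbacks⇒balanced : ∀ {a b c d} → NoSwitchbacks a b c d → BalancedRec π M a b c d
  noSwitchbacks⇒balanced (left≡0 , right≡0) = trans left≡0 (sym right≡0)

  IrregularRecsEmpty : Set
  IrregularRecsEmpty = ∀ a b c d → Rec π a b c d → Irregular a b c d → EmptyRec π M a b c d

  StraightRecsBalanced : Set
  StraightRecsBalanced = ∀ a b c d → Rec π a b c d → StraightRec π a b c d → BalancedRec π M a b c d

  BalancedIfRegular : (a b c d : Fin n) → Set
  BalancedIfRegular a b c d = Rec π a b c d → Regular a b c d → BalancedRec π M a b c d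

  isLeft? : ∀ x → Dec (IsLeft π x)
  isLeft? x = any? (λ j → (x <? j) ×-dec before? π j x)

  isRight? : ∀ x → Dec (IsRight π x)
  isRight? x = any? (λ j → (j <? x) ×-dec before? π x j)

  straightRec : ∀ {a b c d} → Rec π a b c d →
    ¬ IsLeft π a → ¬ IsLeft π b → ¬ IsRight π c → ¬ IsRight π d → StraightRec π a b c d
  straightRec {a} {b} {c} (ab , bc , cd , c<a , d<a , c<b , _) ¬la ¬lb ¬rc ¬rd =
      inj₂ ((c , c<a , ac) , ¬la)
    , inj₂ ((c , c<b , bc) , ¬lb)
    , inj₁ ((a , c<a , ac) , ¬rc)
    , inj₁ ((a , d<a , <-trans ac cd) , ¬rd)
    where ac = <-trans ab bc

  module Reduction (irregular-empty : IrregularRecsEmpty) where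

    noSwitchbacks-if-b<a : ∀ {a b c d} → Rec π a b c d → b < a → NoSwitchbacks a b c d
    noSwitchbacks-if-b<a r b<a =
      emptyRec⇒noSwitchbacks (irregular-empty _ _ _ _ r (λ (a<b , _) → <-asym a<b b<a))

    noSwitchbacks-if-d<c : ∀ {a b c d} → Rec π a b c d → d < c → NoSwitchbacks a b c d
    noSwitchbacks-if-d<c r d<c =
      emptyRec⇒noSwitchbacks (irregular-empty _ _ _ _ r (λ (_ , c<d) → <-asym c<d d<c))

    noSwitchbacks-under-earlier-larger : ∀ {a b c d j} → Rec π a b c d → a < b →
      Before π j a → b < j → NoSwitchbacks a b c d
    noSwitchbacks-under-earlier-larger {a = a} {j = j}
      (ab , bc , cd , c<a , d<a , c<b , d<b) a<b ja b<j =
        m+n≡0⇒n≡0 _ (trans (sym (#Window-split-position ja ab (above⇒¬strictlyBetween c<a d<a)))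
                           (proj₁ jbcd))
      , m+n≡0⇒m≡0 _ (trans (sym (#Window-split-value a<b b<j (inj₁ bc)))
                           (trans (#Window-flip a j) (proj₂ jacd)))
      where
        a<j = <-trans a<b b<j
        jbcd = noSwitchbacks-if-b<a
          (<-trans ja ab , bc , cd , <-trans c<b b<j , <-trans d<b b<j , c<b , d<b) b<j
        jacd = noSwitchbacks-if-b<a
          (ja , <-trans ab bc , cd , <-trans c<a a<j , <-trans d<a a<j , c<a , d<a) a<j

    noSwitchbacks-over-later-smaller : ∀ {a b c d j} → Rec π a b c d → c < d →
      Before π d j → j < c → NoSwitchbacks a b c d
    noSwitchbacks-over-later-smaller {d = d} {j = j}
      (ab , bc , cd , c<a , d<a , c<b , d<b) c<d dj j<c =
        m+n≡0⇒n≡0 _ (trans (sym (#Window-split-value j<c c<d (inj₂ bc)))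
                           (trans (#Window-flip j d) (proj₁ abdj)))
      , m+n≡0⇒m≡0 _ (trans (sym (#Window-split-position cd dj (below⇒¬strictlyBetween d<a d<b)))
                           (proj₂ abcj))
      where
        j<d = <-trans j<c c<d
        abcj = noSwitchbacks-if-d<c
          (ab , bc , <-trans cd dj , c<a , <-trans j<c c<a , c<b , <-trans j<c c<b) j<c
        abdj = noSwitchbacks-if-d<c
          (ab , <-trans bc cd , dj , d<a , <-trans j<d d<a , d<b , <-trans j<d d<b) j<d

    module _ {a b c d j : Fin n} where
      open ≡-Reasoning

      balanced-raising-a : Rec π a b c d → Before π j a → a < j → j < b →
        BalancedRec π M j b c d → BalancedRec π M a b c d
      balanced-raising-a (ab , bc , cd , c<a , d<a , _) ja a<j j<b balanced = begin
        #Window RLw a b c d                      ≡⟨ cong (_+ _) (proj₁ jacd) ⟨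
        #Window RLw j a c d + #Window RLw a b c d
          ≡⟨ #Window-split-position ja ab (above⇒¬strictlyBetween c<a d<a) ⟨
        #Window RLw j b c d                      ≡⟨ balanced ⟩
        #Window LRw c d j b
          ≡⟨ cong (_+ _) (trans (#Window-flip a j) (proj₂ jacd)) ⟨
        #Window LRw c d a j + #Window LRw c d j b
          ≡⟨ #Window-split-value a<j j<b (inj₁ (<-trans ja (<-trans ab bc))) ⟨
        #Window LRw c d a b                      ∎
        where
          jacd = noSwitchbacks-if-b<a
            (ja , <-trans ab bc , cd , <-trans c<a a<j , <-trans d<a a<j , c<a , d<a) a<j

      balanced-raising-b : Rec π a b c d → a < b → Before π a j → Before π j b → b < j →
        BalancedRec π M a j c d → BalancedRec π M a b c d
      balanced-raising-b (_ , bc , cd , _ , _ , c<b , d<b) a<b aj jb b<j balanced = begin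
        #Window RLw a b c d
          ≡⟨ #Window-split-position aj jb (above⇒¬strictlyBetween c<j d<j) ⟩
        #Window RLw a j c d + #Window RLw j b c d ≡⟨ cong (_ +_) (proj₁ jbcd) ⟩
        #Window RLw a j c d + 0                  ≡⟨ +-identityʳ _ ⟩
        #Window RLw a j c d                      ≡⟨ balanced ⟩
        #Window LRw c d a j                      ≡⟨ #Window-split-value a<b b<j (inj₁ bc) ⟩
        #Window LRw c d a b + #Window LRw c d b j
          ≡⟨ cong (_ +_) (trans (#Window-flip b j) (proj₂ jbcd)) ⟩
        #Window LRw c d a b + 0                  ≡⟨ +-identityʳ _ ⟩
        #Window LRw c d a b                      ∎
        where
          c<j = <-trans c<b b<j
          d<j = <-trans d<b b<j
          jbcd = noSwitchbacks-if-b<a (jb , bc , cd , c<j , d<j , c<b , d<b) b<j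

      balanced-lowering-c : Rec π a b c d → c < d → Before π c j → Before π j d → j < c →
        BalancedRec π M a b j d → BalancedRec π M a b c d
      balanced-lowering-c (ab , bc , _ , c<a , _ , c<b , _) c<d cj jd j<c balanced = begin
        #Window RLw a b c d
          ≡⟨ cong (_+ _) (trans (#Window-flip j c) (proj₁ abcj)) ⟨
        #Window RLw a b j c + #Window RLw a b c d
          ≡⟨ #Window-split-value j<c c<d (inj₂ bc) ⟨
        #Window RLw a b j d                      ≡⟨ balanced ⟩
        #Window LRw j d a b                      ≡⟨ cong (_+ _) (proj₂ abcj) ⟨
        #Window LRw c j a b + #Window LRw j d a b
          ≡⟨ #Window-split-position cj jd (below⇒¬strictlyBetween j<a j<b) ⟨
        #Window LRw c d a b                      ∎
        where
          j<a = <-trans j<c c<a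
          j<b = <-trans j<c c<b
          abcj = noSwitchbacks-if-d<c (ab , bc , cj , c<a , j<a , c<b , j<b) j<c

      balanced-lowering-d : Rec π a b c d → Before π d j → c < j → j < d →
        BalancedRec π M a b c j → BalancedRec π M a b c d
      balanced-lowering-d (ab , bc , cd , _ , d<a , _ , d<b) dj c<j j<d balanced = begin
        #Window RLw a b c d
          ≡⟨ #Window-split-value c<j j<d (inj₂ (<-trans bc (<-trans cd dj))) ⟩
        #Window RLw a b c j + #Window RLw a b j d
          ≡⟨ cong (_ +_) (trans (#Window-flip j d) (proj₁ abdj)) ⟩
        #Window RLw a b c j + 0                  ≡⟨ +-identityʳ _ ⟩
        #Window RLw a b c j                      ≡⟨ balanced ⟩
        #Window LRw c j a b
          ≡⟨ #Window-split-position cd dj (below⇒¬strictlyBetween d<a d<b) ⟩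
        #Window LRw c d a b + #Window LRw d j a b ≡⟨ cong (_ +_) (proj₂ abdj) ⟩
        #Window LRw c d a b + 0                  ≡⟨ +-identityʳ _ ⟩
        #Window LRw c d a b                      ∎
        where
          abdj = noSwitchbacks-if-d<c
            (ab , <-trans bc cd , dj , d<a , <-trans j<d d<a , d<b , <-trans j<d d<b) j<d

      balanced-if-a-isLeft : Inversion π j a → BalancedIfRegular j b c d → BalancedIfRegular a b c d
      balanced-if-a-isLeft (a<j , ja) balanced-jbcd
        r@(ab , bc , cd , c<a , d<a , c<b , d<b) (a<b , c<d) with <-cmp j b
      ... | tri< j<b _ _ = balanced-raising-a r ja a<j j<b (balanced-jbcd
              (<-trans ja ab , bc , cd , <-trans c<a a<j , <-trans d<a a<j , c<b , d<b) (j<b , c<d))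
      ... | tri≈ _ refl _ = ⊥-elim (<-asym ja ab)
      ... | tri> _ _ b<j = noSwitchbacks⇒balanced (noSwitchbacks-under-earlier-larger r a<b ja b<j)

      balanced-if-b-isLeft : Inversion π j b → BalancedIfRegular a j c d → BalancedIfRegular a b c d
      balanced-if-b-isLeft (b<j , jb) balanced-ajcd
        r@(_ , bc , cd , c<a , d<a , c<b , d<b) (a<b , c<d) with before-cmp a j
      ... | tri< aj _ _ = balanced-raising-b r a<b aj jb b<j (balanced-ajcd
              (aj , <-trans jb bc , cd , c<a , d<a , <-trans c<b b<j , <-trans d<b b<j)
              (<-trans a<b b<j , c<d))
      ... | tri≈ _ refl _ = ⊥-elim (<-asym a<b b<j)
      ... | tri> _ _ ja = noSwitchbacks⇒balanced (noSwitchbacks-under-earlier-larger r a<b ja b<j)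

      balanced-if-c-isRight : Inversion π c j → BalancedIfRegular a b j d → BalancedIfRegular a b c d
      balanced-if-c-isRight (j<c , cj) balanced-abjd
        r@(ab , bc , _ , c<a , d<a , c<b , d<b) (a<b , c<d) with before-cmp j d
      ... | tri< jd _ _ = balanced-lowering-c r c<d cj jd j<c (balanced-abjd
              (ab , <-trans bc cj , jd , <-trans j<c c<a , d<a , <-trans j<c c<b , d<b)
              (a<b , <-trans j<c c<d))
      ... | tri≈ _ refl _ = ⊥-elim (<-asym j<c c<d)
      ... | tri> _ _ dj = noSwitchbacks⇒balanced (noSwitchbacks-over-later-smaller r c<d dj j<c)

      balanced-if-d-isRight : Inversion π d j → BalancedIfRegular a b c j → BalancedIfRegular a b c d
      balanced-if-d-isRight (j<d , dj) balanced-abcj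
        r@(ab , bc , cd , c<a , d<a , c<b , d<b) (a<b , c<d) with <-cmp c j
      ... | tri< c<j _ _ = balanced-lowering-d r dj c<j j<d (balanced-abcj
              (ab , bc , <-trans cd dj , c<a , <-trans j<d d<a , c<b , <-trans j<d d<b) (a<b , c<j))
      ... | tri≈ _ refl _ = ⊥-elim (<-asym cd dj)
      ... | tri> _ _ j<c = noSwitchbacks⇒balanced (noSwitchbacks-over-later-smaller r c<d dj j<c)

    balanced-if-regular : StraightRecsBalanced →
      ∀ a b c d → Acc _<ℕ_ (rank a b c d) → BalancedIfRegular a b c d
    balanced-if-regular straight a b c d (acc smaller) r reg
      with isLeft? a | isLeft? b | isRight? c | isRight? d
    ... | yes (j , inv) | _ | _ | _ = balanced-if-a-isLeft inv
          (balanced-if-regular straight j b c d (smaller (rank-raise-a a b c d (proj₁ inv)))) r reg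
    ... | no _ | yes (j , inv) | _ | _ = balanced-if-b-isLeft inv
          (balanced-if-regular straight a j c d (smaller (rank-raise-b a b c d (proj₁ inv)))) r reg
    ... | no _ | no _ | yes (j , inv) | _ = balanced-if-c-isRight inv
          (balanced-if-regular straight a b j d (smaller (rank-lower-c a b c d (proj₁ inv)))) r reg
    ... | no _ | no _ | no _ | yes (j , inv) = balanced-if-d-isRight inv
          (balanced-if-regular straight a b c j (smaller (rank-lower-d a b c d (proj₁ inv)))) r reg
    ... | no ¬la | no ¬lb | no ¬rc | no ¬rd = straight a b c d r (straightRec r ¬la ¬lb ¬rc ¬rd)

  balanced⇒sBalanced : BalancedMarking π M → SBalancedMarking π M
  balanced⇒sBalanced balanced a b c d r = balanced-straight , irregular-empty
    where
      irregular-empty = proj₂ (balanced a b c d r)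
      balanced-straight : StraightRec π a b c d → BalancedRec π M a b c d
      balanced-straight _ with (a <? b) ×-dec (c <? d)
      ... | yes reg = proj₁ (balanced a b c d r) reg
      ... | no irr  = noSwitchbacks⇒balanced (emptyRec⇒noSwitchbacks (irregular-empty irr))

  sBalanced⇒balanced : SBalancedMarking π M → BalancedMarking π M
  sBalanced⇒balanced sBalanced a b c d r =
      balanced-if-regular (λ a b c d r → proj₁ (sBalanced a b c d r)) a b c d (<-wellFounded _) r
    , proj₂ (sBalanced a b c d r)
    where open Reduction (λ a b c d r → proj₂ (sBalanced a b c d r))

lemma5 : (n : ℕ) (π : Permutation′ n) (M : Fin n → List Letter) →
    IsMarking π M → (BalancedMarking π M ⇔ SBalancedMarking π M)
lemma5 n π M _ = mk⇔ balanced⇒sBalanced sBalanced⇒balanced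
  where open Windows π M
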